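{- Let $T_1,\dots,T_k$ be plane rooted trees with $E_i=|E(T_i)|$ edges, and let $T=T_k\vee T_{k-1}\vee\dots\vee T_1$ be the plane rooted tree obtained by identifying all their roots, with $T_k,\dots,T_1$ placed from left to right. Then $$Q(T)=\binom{E_k+E_{k-1}+\dots+E_1}{E_k,E_{k-1},\dots,E_1}_q\,Q(T_k)Q(T_{k-1})\cdots Q(T_1).$$
   Context: A plane rooted tree is a finite tree with a distinguished vertex (the root), embedded in the plane so that it grows upward from the root. A leaf is a vertex of degree $1$ different from the root. For a leaf $v$ of $T$, $r(T,v)$ denotes the number of edges of $T$ lying to the right of the unique path connecting $v$ with the root, and $T-v$ is the plane rooted tree obtained by deleting $v$ and its incident edge. The plucking polynomial $Q(T)\in\mathbb{Z}[q]$ is defined recursively: if $T$ has a single vertex then $Q(T)=1$; otherwise $Q(T)=\sum_{v \text{ leaf of } T} q^{r(T,v)}Q(T-v)$. Notation: $[n]_q=1+q+\dots+q^{n-1}$, $[0]_q!=1$, $[n]_q!=[n]_q\cdots[1]_q$, and the $q$-multinomial coefficient is $\binom{a_1+\dots+a_k}{a_1,\dots,a_k}_q=\frac{[a_1+\dots+a_k]_q!}{[a_1]_q!\cdots[a_k]_q!}$. -}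

module Defs where

open import Data.Nat as ℕ using (ℕ; zero; suc)
open import Data.Integer as ℤ using (ℤ; 0ℤ; 1ℤ)
open import Data.List using (List; []; _∷_; _++_; map; replicate; foldr; concatMap)
open import Data.Product using (_×_; _,_)
open import Relation.Binary.PropositionalEquality using (_≡_)

-- Plane rooted trees: a vertex together with the ordered (left-to-right)
-- list of subtrees growing upward from it.

data PTree : Set where
  node : List PTree → PTree

mutual
  edges : PTree → ℕ
  edges (node cs) = edgesF cs

  edgesF : List PTree → ℕ
  edgesF []       = 0
  edgesF (c ∷ cs) = suc (edges c) ℕ.+ edgesF cs

-- Polynomials in ℤ[q] as coefficient lists (constant term first),
-- compared coefficientwise (so trailing zeros are irrelevant).

Poly : Set
Poly = List ℤ

coeff : Poly → ℕ → ℤ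
coeff []       _       = 0ℤ
coeff (a ∷ p)  zero    = a
coeff (a ∷ p)  (suc n) = coeff p n

infix 4 _≈P_
_≈P_ : Poly → Poly → Set
p ≈P r = ∀ n → coeff p n ≡ coeff r n

infixl 6 _+P_
_+P_ : Poly → Poly → Poly
[]      +P r       = r
(a ∷ p) +P []      = a ∷ p
(a ∷ p) +P (b ∷ r) = (a ℤ.+ b) ∷ (p +P r)

scale : ℤ → Poly → Poly
scale a = map (a ℤ.*_)

infixl 7 _*P_
_*P_ : Poly → Poly → Poly
[]      *P r = []
(a ∷ p) *P r = scale a r +P (0ℤ ∷ (p *P r))

oneP : Poly
oneP = 1ℤ ∷ []

qpow : ℕ → Poly
qpow n = replicate n 0ℤ ++ (1ℤ ∷ [])

sumP : List Poly → Poly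
sumP = foldr _+P_ []

prodP : List Poly → Poly
prodP = foldr _*P_ oneP

qint : ℕ → Poly
qint n = replicate n 1ℤ

qfact : ℕ → Poly
qfact zero    = oneP
qfact (suc n) = qint (suc n) *P qfact n

-- Leaves of a plane rooted tree, each given as the pair (r(T,v), T - v).
-- A leaf is a non-root vertex with no children (degree 1).
-- For a forest cs = c₁ … cₘ hanging from a vertex, a leaf inside cᵢ has,
-- to the right of its path, its right-edges inside cᵢ plus all edges of
-- cᵢ₊₁,…,cₘ together with their joining edges (= edgesF of the rest).

pluckF : List PTree → List (ℕ × List PTree)
pluckF []              = []
pluckF (node ds ∷ cs)  =
  leafHere ds
  ++ map (λ { (r , ds') → (r ℕ.+ edgesF cs , node ds' ∷ cs) }) (pluckF ds)
  ++ map (λ { (r , cs') → (r , node ds ∷ cs') }) (pluckF cs)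
  where
  leafHere : List PTree → List (ℕ × List PTree)
  leafHere []      = (edgesF cs , cs) ∷ []
  leafHere (_ ∷ _) = []

pluck : PTree → List (ℕ × PTree)
pluck (node cs) = map (λ { (r , cs') → (r , node cs') }) (pluckF cs)

-- Plucking polynomial.  Q'(fuel) with fuel = number of edges; each
-- plucking removes exactly one edge, so the fuel is exact.

Q' : ℕ → PTree → Poly
Q' zero    _               = oneP
Q' (suc n) (node [])       = oneP
Q' (suc n) (node (c ∷ cs)) =
  sumP (map (λ { (r , t') → qpow r *P Q' n t' }) (pluck (node (c ∷ cs))))

Q : PTree → Poly
Q t = Q' (edges t) t

children : PTree → List PTree
children (node cs) = cs

wedge : List PTree → PTree
wedge ts = node (concatMap children ts)

{-# OPTIONS --safe #-}

-- Write Q(F) for the plucking polynomial of the tree whose root carries the forest F.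
-- Plucking a leaf of A ++ B either plucks a leaf of A, which then also has the
-- b = |E(B)| edges of B to its right, or plucks a leaf of B, with r unchanged.  By
-- induction on the number of edges, the two families of terms contribute
-- [a] q^b [a+b-1]! Q(A) Q(B) and [b] [a+b-1]! Q(A) Q(B), and the q-Pascal rule
-- [a+b] = [a] q^b + [b] gives  [a]! [b]! Q(A ++ B) = [a+b]! Q(A) Q(B).  The wedge of k
-- trees follows by induction on k, cancelling factorials: they have constant term 1,
-- so they are not zero divisors in ℤ[q].
module Submission where

open import Defs
open import Data.Nat as ℕ using (ℕ; zero; suc; _≤_)
import Data.Nat.Properties as ℕP
open import Data.Nat.ListAction using (sum)
open import Data.Integer as ℤ using (0ℤ; 1ℤ)
import Data.Integer.Properties as ℤP
open import Data.List using (List; []; _∷_; _++_; length; map; drop; concatMap)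
import Data.List.Properties as ListP
open import Data.List.Relation.Unary.All as All using (All; []; _∷_)
import Data.List.Relation.Unary.All.Properties as AllP
open import Data.Product using (_×_; _,_; proj₁; proj₂)
open import Function using (_∘_)
open import Level using (0ℓ)
open import Algebra.Bundles using (CommutativeMonoid; CommutativeSemiring)
import Algebra.Structures as Structures
open import Algebra.Structures.Biased using (isCommutativeMonoidˡ; isCommutativeSemiringˡ)
import Algebra.Properties.CommutativeSemigroup as CommutativeSemigroupProperties
open import Algebra.Properties.AbelianGroup ℤP.+-0-abelianGroup using (∙-cancelˡ)
import Algebra.Solver.Ring.NaturalCoefficients.Default as NaturalCoefficientsSolver
open import Relation.Binary.Structures using (IsEquivalence)
open import Relation.Binary.Bundles using (Setoid)
import Relation.Binary.Reasoning.Setoid as SetoidReasoning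
open import Relation.Binary.PropositionalEquality
  using (_≡_; refl; sym; trans; cong; cong₂; subst; module ≡-Reasoning)

-- The commutative semiring ℤ[q]

-- A record rather than _≈P_ itself, so that p and r can be inferred from a proof of p ≋ r.
infix 4 _≋_
record _≋_ (p r : Poly) : Set where
  constructor coeffwise
  field coeff-≡ : p ≈P r
open _≋_

≋-refl : ∀ {p} → p ≋ p
≋-refl = coeffwise λ _ → refl

≋-sym : ∀ {p r} → p ≋ r → r ≋ p
≋-sym e = coeffwise λ n → sym (coeff-≡ e n)

≋-trans : ∀ {p r s} → p ≋ r → r ≋ s → p ≋ s
≋-trans e f = coeffwise λ n → trans (coeff-≡ e n) (coeff-≡ f n)

≋-isEquivalence : IsEquivalence _≋_
≋-isEquivalence = record { refl = ≋-refl ; sym = ≋-sym ; trans = ≋-trans }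

≋-setoid : Setoid 0ℓ 0ℓ
≋-setoid = record { isEquivalence = ≋-isEquivalence }

module ≋-Reasoning = SetoidReasoning ≋-setoid

≡⇒≋ : ∀ {p r} → p ≡ r → p ≋ r
≡⇒≋ refl = ≋-refl

∷-cong : ∀ {a b p r} → a ≡ b → p ≋ r → a ∷ p ≋ b ∷ r
∷-cong refl e = coeffwise λ { zero → refl ; (suc n) → coeff-≡ e n }

0∷-≋[] : ∀ {p} → p ≋ [] → 0ℤ ∷ p ≋ []
0∷-≋[] e = coeffwise λ { zero → refl ; (suc n) → coeff-≡ e n }

coeff-+P : ∀ p r n → coeff (p +P r) n ≡ coeff p n ℤ.+ coeff r n
coeff-+P []      r       n       = sym (ℤP.+-identityˡ (coeff r n))
coeff-+P (a ∷ p) []      n       = sym (ℤP.+-identityʳ (coeff (a ∷ p) n))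
coeff-+P (a ∷ p) (b ∷ r) zero    = refl
coeff-+P (a ∷ p) (b ∷ r) (suc n) = coeff-+P p r n

coeff-scale : ∀ a p n → coeff (scale a p) n ≡ a ℤ.* coeff p n
coeff-scale a []      n       = sym (ℤP.*-zeroʳ a)
coeff-scale a (b ∷ p) zero    = refl
coeff-scale a (b ∷ p) (suc n) = coeff-scale a p n

+P-cong : ∀ {p p′ r r′} → p ≋ p′ → r ≋ r′ → p +P r ≋ p′ +P r′
+P-cong {p} {p′} {r} {r′} e f = coeffwise λ n → begin
  coeff (p +P r) n              ≡⟨ coeff-+P p r n ⟩
  coeff p n ℤ.+ coeff r n       ≡⟨ cong₂ ℤ._+_ (coeff-≡ e n) (coeff-≡ f n) ⟩
  coeff p′ n ℤ.+ coeff r′ n     ≡⟨ coeff-+P p′ r′ n ⟨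
  coeff (p′ +P r′) n            ∎
  where open ≡-Reasoning

+P-assoc : ∀ p r s → (p +P r) +P s ≋ p +P (r +P s)
+P-assoc p r s = coeffwise λ n → begin
  coeff ((p +P r) +P s) n                      ≡⟨ coeff-+P (p +P r) s n ⟩
  coeff (p +P r) n ℤ.+ coeff s n               ≡⟨ cong (ℤ._+ coeff s n) (coeff-+P p r n) ⟩
  coeff p n ℤ.+ coeff r n ℤ.+ coeff s n        ≡⟨ ℤP.+-assoc (coeff p n) (coeff r n) (coeff s n) ⟩
  coeff p n ℤ.+ (coeff r n ℤ.+ coeff s n)      ≡⟨ cong (λ x → coeff p n ℤ.+ x) (coeff-+P r s n) ⟨
  coeff p n ℤ.+ coeff (r +P s) n               ≡⟨ coeff-+P p (r +P s) n ⟨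
  coeff (p +P (r +P s)) n                      ∎
  where open ≡-Reasoning

+P-comm : ∀ p r → p +P r ≋ r +P p
+P-comm p r = coeffwise λ n → begin
  coeff (p +P r) n          ≡⟨ coeff-+P p r n ⟩
  coeff p n ℤ.+ coeff r n   ≡⟨ ℤP.+-comm (coeff p n) (coeff r n) ⟩
  coeff r n ℤ.+ coeff p n   ≡⟨ coeff-+P r p n ⟨
  coeff (r +P p) n          ∎
  where open ≡-Reasoning

+P-identityʳ : ∀ p → p +P [] ≋ p
+P-identityʳ p = coeffwise λ n → trans (coeff-+P p [] n) (ℤP.+-identityʳ (coeff p n))

+P-isCommutativeMonoid : Structures.IsCommutativeMonoid _≋_ _+P_ []
+P-isCommutativeMonoid = isCommutativeMonoidˡ record
  { isSemigroup = record
    { isMagma = record { isEquivalence = ≋-isEquivalence ; ∙-cong = +P-cong }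
    ; assoc   = +P-assoc
    }
  ; identityˡ = λ _ → ≋-refl
  ; comm      = +P-comm
  }

+P-commutativeMonoid : CommutativeMonoid 0ℓ 0ℓ
+P-commutativeMonoid = record { isCommutativeMonoid = +P-isCommutativeMonoid }

open CommutativeSemigroupProperties (CommutativeMonoid.commutativeSemigroup +P-commutativeMonoid)
  using (interchange; x∙yz≈y∙xz)

scale-cong : ∀ a {p r} → p ≋ r → scale a p ≋ scale a r
scale-cong a {p} {r} e = coeffwise λ n → begin
  coeff (scale a p) n   ≡⟨ coeff-scale a p n ⟩
  a ℤ.* coeff p n       ≡⟨ cong (a ℤ.*_) (coeff-≡ e n) ⟩
  a ℤ.* coeff r n       ≡⟨ coeff-scale a r n ⟨
  coeff (scale a r) n   ∎
  where open ≡-Reasoning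

scale-zero : ∀ p → scale 0ℤ p ≋ []
scale-zero p = coeffwise (coeff-scale 0ℤ p)

scale-identity : ∀ p → scale 1ℤ p ≋ p
scale-identity p = coeffwise λ n → trans (coeff-scale 1ℤ p n) (ℤP.*-identityˡ (coeff p n))

scale-scale : ∀ a b p → scale (a ℤ.* b) p ≋ scale a (scale b p)
scale-scale a b p = coeffwise λ n → begin
  coeff (scale (a ℤ.* b) p) n   ≡⟨ coeff-scale (a ℤ.* b) p n ⟩
  a ℤ.* b ℤ.* coeff p n         ≡⟨ ℤP.*-assoc a b (coeff p n) ⟩
  a ℤ.* (b ℤ.* coeff p n)       ≡⟨ cong (a ℤ.*_) (coeff-scale b p n) ⟨
  a ℤ.* coeff (scale b p) n     ≡⟨ coeff-scale a (scale b p) n ⟨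
  coeff (scale a (scale b p)) n ∎
  where open ≡-Reasoning

scale-+ℤ : ∀ a b p → scale (a ℤ.+ b) p ≋ scale a p +P scale b p
scale-+ℤ a b p = coeffwise λ n → begin
  coeff (scale (a ℤ.+ b) p) n                        ≡⟨ coeff-scale (a ℤ.+ b) p n ⟩
  (a ℤ.+ b) ℤ.* coeff p n                            ≡⟨ ℤP.*-distribʳ-+ (coeff p n) a b ⟩
  a ℤ.* coeff p n ℤ.+ b ℤ.* coeff p n                ≡⟨ cong₂ ℤ._+_ (coeff-scale a p n) (coeff-scale b p n) ⟨
  coeff (scale a p) n ℤ.+ coeff (scale b p) n        ≡⟨ coeff-+P (scale a p) (scale b p) n ⟨
  coeff (scale a p +P scale b p) n                   ∎
  where open ≡-Reasoning

scale-+P : ∀ a p r → scale a (p +P r) ≋ scale a p +P scale a r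
scale-+P a p r = coeffwise λ n → begin
  coeff (scale a (p +P r)) n                         ≡⟨ coeff-scale a (p +P r) n ⟩
  a ℤ.* coeff (p +P r) n                             ≡⟨ cong (a ℤ.*_) (coeff-+P p r n) ⟩
  a ℤ.* (coeff p n ℤ.+ coeff r n)                    ≡⟨ ℤP.*-distribˡ-+ a (coeff p n) (coeff r n) ⟩
  a ℤ.* coeff p n ℤ.+ a ℤ.* coeff r n                ≡⟨ cong₂ ℤ._+_ (coeff-scale a p n) (coeff-scale a r n) ⟨
  coeff (scale a p) n ℤ.+ coeff (scale a r) n        ≡⟨ coeff-+P (scale a p) (scale a r) n ⟨
  coeff (scale a p +P scale a r) n                   ∎
  where open ≡-Reasoning

*P-congʳ : ∀ p {r r′} → r ≋ r′ → p *P r ≋ p *P r′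
*P-congʳ []      e = ≋-refl
*P-congʳ (a ∷ p) e = +P-cong (scale-cong a e) (∷-cong refl (*P-congʳ p e))

*P-zeroʳ : ∀ p → p *P [] ≋ []
*P-zeroʳ []      = ≋-refl
*P-zeroʳ (a ∷ p) = 0∷-≋[] (*P-zeroʳ p)

*P-∷ʳ : ∀ p b r → p *P (b ∷ r) ≋ scale b p +P (0ℤ ∷ p *P r)
*P-∷ʳ []      b r = ≋-sym (0∷-≋[] ≋-refl)
*P-∷ʳ (a ∷ p) b r = ∷-cong (cong (ℤ._+ 0ℤ) (ℤP.*-comm a b)) (begin
  scale a r +P p *P (b ∷ r)                   ≈⟨ +P-cong ≋-refl (*P-∷ʳ p b r) ⟩
  scale a r +P (scale b p +P (0ℤ ∷ p *P r))   ≈⟨ x∙yz≈y∙xz (scale a r) (scale b p) (0ℤ ∷ p *P r) ⟩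
  scale b p +P (scale a r +P (0ℤ ∷ p *P r))   ∎)
  where open ≋-Reasoning

*P-comm : ∀ p r → p *P r ≋ r *P p
*P-comm []      r = ≋-sym (*P-zeroʳ r)
*P-comm (a ∷ p) r = ≋-trans (+P-cong ≋-refl (∷-cong refl (*P-comm p r))) (≋-sym (*P-∷ʳ r a p))

*P-congˡ : ∀ {p p′} r → p ≋ p′ → p *P r ≋ p′ *P r
*P-congˡ {p} {p′} r e = ≋-trans (*P-comm p r) (≋-trans (*P-congʳ r e) (*P-comm r p′))

*P-cong : ∀ {p p′ r r′} → p ≋ p′ → r ≋ r′ → p *P r ≋ p′ *P r′
*P-cong {p′ = p′} {r = r} e f = ≋-trans (*P-congˡ r e) (*P-congʳ p′ f)

*P-identityˡ : ∀ p → oneP *P p ≋ p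
*P-identityˡ p = ≋-trans (+P-cong ≋-refl (0∷-≋[] ≋-refl))
                         (≋-trans (+P-identityʳ (scale 1ℤ p)) (scale-identity p))

*P-distribʳ : ∀ r p p′ → (p +P p′) *P r ≋ p *P r +P p′ *P r
*P-distribʳ r []      p′       = ≋-refl
*P-distribʳ r (a ∷ p) []       = ≋-sym (+P-identityʳ _)
*P-distribʳ r (a ∷ p) (b ∷ p′) = begin
  scale (a ℤ.+ b) r +P (0ℤ ∷ (p +P p′) *P r)
    ≈⟨ +P-cong (scale-+ℤ a b r) (∷-cong refl (*P-distribʳ r p p′)) ⟩
  (scale a r +P scale b r) +P ((0ℤ ∷ p *P r) +P (0ℤ ∷ p′ *P r))
    ≈⟨ interchange (scale a r) (scale b r) (0ℤ ∷ p *P r) (0ℤ ∷ p′ *P r) ⟩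
  (scale a r +P (0ℤ ∷ p *P r)) +P (scale b r +P (0ℤ ∷ p′ *P r)) ∎
  where open ≋-Reasoning

scale-*P : ∀ a r s → scale a r *P s ≋ scale a (r *P s)
scale-*P a []      s = ≋-refl
scale-*P a (b ∷ r) s = begin
  scale (a ℤ.* b) s +P (0ℤ ∷ scale a r *P s)
    ≈⟨ +P-cong (scale-scale a b s) (∷-cong (sym (ℤP.*-zeroʳ a)) (scale-*P a r s)) ⟩
  scale a (scale b s) +P (a ℤ.* 0ℤ ∷ scale a (r *P s))
    ≈⟨ scale-+P a (scale b s) (0ℤ ∷ r *P s) ⟨
  scale a (scale b s +P (0ℤ ∷ r *P s)) ∎
  where open ≋-Reasoning

0∷-*P : ∀ p r → (0ℤ ∷ p) *P r ≋ 0ℤ ∷ p *P r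
0∷-*P p r = +P-cong (scale-zero r) ≋-refl

*P-assoc : ∀ p r s → (p *P r) *P s ≋ p *P (r *P s)
*P-assoc []      r s = ≋-refl
*P-assoc (a ∷ p) r s = begin
  (scale a r +P (0ℤ ∷ p *P r)) *P s        ≈⟨ *P-distribʳ s (scale a r) (0ℤ ∷ p *P r) ⟩
  scale a r *P s +P (0ℤ ∷ p *P r) *P s     ≈⟨ +P-cong (scale-*P a r s) (0∷-*P (p *P r) s) ⟩
  scale a (r *P s) +P (0ℤ ∷ p *P r *P s)   ≈⟨ +P-cong ≋-refl (∷-cong refl (*P-assoc p r s)) ⟩
  scale a (r *P s) +P (0ℤ ∷ p *P (r *P s)) ∎
  where open ≋-Reasoning

Poly-commutativeSemiring : CommutativeSemiring 0ℓ 0ℓ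
Poly-commutativeSemiring = record
  { Carrier = Poly ; _≈_ = _≋_ ; _+_ = _+P_ ; _*_ = _*P_ ; 0# = [] ; 1# = oneP
  ; isCommutativeSemiring = isCommutativeSemiringˡ record
    { +-isCommutativeMonoid = +P-isCommutativeMonoid
    ; *-isCommutativeMonoid = isCommutativeMonoidˡ record
      { isSemigroup = record
        { isMagma = record { isEquivalence = ≋-isEquivalence ; ∙-cong = *P-cong }
        ; assoc   = *P-assoc
        }
      ; identityˡ = *P-identityˡ
      ; comm      = *P-comm
      }
    ; distribʳ = *P-distribʳ
    ; zeroˡ    = λ _ → ≋-refl
    }
  }

open CommutativeSemiring Poly-commutativeSemiring using () renaming (distribˡ to *P-distribˡ)
open NaturalCoefficientsSolver Poly-commutativeSemiring using (solve; _:=_; _:+_; _:*_)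

sumP-++ : ∀ ps rs → sumP (ps ++ rs) ≋ sumP ps +P sumP rs
sumP-++ []       rs = ≋-refl
sumP-++ (p ∷ ps) rs = ≋-trans (+P-cong (≋-refl {p}) (sumP-++ ps rs)) (≋-sym (+P-assoc p (sumP ps) (sumP rs)))

sumP-cong : ∀ {A : Set} {f g : A → Poly} {xs} → All (λ x → f x ≋ g x) xs → sumP (map f xs) ≋ sumP (map g xs)
sumP-cong []       = ≋-refl
sumP-cong (e ∷ es) = +P-cong e (sumP-cong es)

*P-sumP : ∀ {A : Set} p (f : A → Poly) xs → p *P sumP (map f xs) ≋ sumP (map (λ x → p *P f x) xs)
*P-sumP p f []       = *P-zeroʳ p
*P-sumP p f (x ∷ xs) = ≋-trans (*P-distribˡ p (f x) (sumP (map f xs))) (+P-cong (≋-refl {p *P f x}) (*P-sumP p f xs))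

qpow-+ : ∀ r b → qpow (r ℕ.+ b) ≋ qpow r *P qpow b
qpow-+ zero    b = ≋-sym (*P-identityˡ (qpow b))
qpow-+ (suc r) b = ≋-trans (∷-cong refl (qpow-+ r b)) (≋-sym (0∷-*P (qpow r) (qpow b)))

qint-+ : ∀ b a → qint (b ℕ.+ a) ≋ qpow b *P qint a +P qint b
qint-+ zero    a = ≋-sym (≋-trans (+P-identityʳ _) (*P-identityˡ (qint a)))
qint-+ (suc b) a = ≋-trans (∷-cong refl (qint-+ b a)) (≋-sym (+P-cong (0∷-*P (qpow b) (qint a)) ≋-refl))

coeff-drop : ∀ p n → coeff p (suc n) ≡ coeff (drop 1 p) n
coeff-drop []      n = refl
coeff-drop (a ∷ p) n = refl

coeff-*P-zero : ∀ p r → coeff (p *P r) 0 ≡ coeff p 0 ℤ.* coeff r 0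
coeff-*P-zero []      r = refl
coeff-*P-zero (a ∷ p) r =
  trans (coeff-+P (scale a r) (0ℤ ∷ p *P r) 0) (trans (ℤP.+-identityʳ _) (coeff-scale a r 0))

coeff-*P-suc : ∀ p r n → coeff (p *P r) (suc n) ≡ coeff p 0 ℤ.* coeff r (suc n) ℤ.+ coeff (drop 1 p *P r) n
coeff-*P-suc []      r n = refl
coeff-*P-suc (a ∷ p) r n =
  trans (coeff-+P (scale a r) (0ℤ ∷ p *P r) (suc n)) (cong (ℤ._+ coeff (p *P r) n) (coeff-scale a r (suc n)))

*P-cancelʳ : ∀ {c} → coeff c 0 ≡ 1ℤ → ∀ {p r} → p *P c ≋ r *P c → p ≋ r
*P-cancelʳ {c} c₀≡1 {p} {r} pc≋rc = coeffwise λ n → coeffs-≡ n p r pc≋rc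
  where
  open ≡-Reasoning
  constant-≡ : ∀ p r → p *P c ≋ r *P c → coeff p 0 ≡ coeff r 0
  constant-≡ p r e = begin
    coeff p 0                   ≡⟨ ℤP.*-identityʳ (coeff p 0) ⟨
    coeff p 0 ℤ.* 1ℤ            ≡⟨ cong (coeff p 0 ℤ.*_) c₀≡1 ⟨
    coeff p 0 ℤ.* coeff c 0     ≡⟨ coeff-*P-zero p c ⟨
    coeff (p *P c) 0            ≡⟨ coeff-≡ e 0 ⟩
    coeff (r *P c) 0            ≡⟨ coeff-*P-zero r c ⟩
    coeff r 0 ℤ.* coeff c 0     ≡⟨ cong (coeff r 0 ℤ.*_) c₀≡1 ⟩
    coeff r 0 ℤ.* 1ℤ            ≡⟨ ℤP.*-identityʳ (coeff r 0) ⟩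
    coeff r 0                   ∎

  coeffs-≡ : ∀ n p r → p *P c ≋ r *P c → coeff p n ≡ coeff r n
  coeffs-≡ zero    p r e = constant-≡ p r e
  coeffs-≡ (suc n) p r e = begin
    coeff p (suc n)       ≡⟨ coeff-drop p n ⟩
    coeff (drop 1 p) n    ≡⟨ coeffs-≡ n (drop 1 p) (drop 1 r) tails-≋ ⟩
    coeff (drop 1 r) n    ≡⟨ coeff-drop r n ⟨
    coeff r (suc n)       ∎
    where
    tails-≋ : drop 1 p *P c ≋ drop 1 r *P c
    tails-≋ = coeffwise λ k → ∙-cancelˡ (coeff p 0 ℤ.* coeff c (suc k)) _ _ (begin
      coeff p 0 ℤ.* coeff c (suc k) ℤ.+ coeff (drop 1 p *P c) k   ≡⟨ coeff-*P-suc p c k ⟨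
      coeff (p *P c) (suc k)                                      ≡⟨ coeff-≡ e (suc k) ⟩
      coeff (r *P c) (suc k)                                      ≡⟨ coeff-*P-suc r c k ⟩
      coeff r 0 ℤ.* coeff c (suc k) ℤ.+ coeff (drop 1 r *P c) k
        ≡⟨ cong (λ x → x ℤ.* coeff c (suc k) ℤ.+ coeff (drop 1 r *P c) k) (constant-≡ p r e) ⟨
      coeff p 0 ℤ.* coeff c (suc k) ℤ.+ coeff (drop 1 r *P c) k   ∎)

qfact-constant : ∀ n → coeff (qfact n) 0 ≡ 1ℤ
qfact-constant zero    = refl
qfact-constant (suc n) = trans (coeff-*P-zero (qint (suc n)) (qfact n)) (cong (1ℤ ℤ.*_) (qfact-constant n))

-- Pluckings of a concatenated forest

edgesF-++ : ∀ A B → edgesF (A ++ B) ≡ edgesF A ℕ.+ edgesF B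
edgesF-++ []      B = refl
edgesF-++ (c ∷ A) B =
  trans (cong (suc (edges c) ℕ.+_) (edgesF-++ A B)) (sym (ℕP.+-assoc (suc (edges c)) (edgesF A) (edgesF B)))

edges-wedge : ∀ ts → edges (wedge ts) ≡ sum (map edges ts)
edges-wedge []            = refl
edges-wedge (node A ∷ ts) = trans (edgesF-++ A (concatMap children ts)) (cong (edgesF A ℕ.+_) (edges-wedge ts))

Plucking : Set
Plucking = ℕ × List PTree

leafPlucking : List PTree → List PTree → List Plucking
leafPlucking []      cs = (edgesF cs , cs) ∷ []
leafPlucking (_ ∷ _) cs = []

under : List PTree → Plucking → Plucking
under cs (r , ds′) = (r ℕ.+ edgesF cs , node ds′ ∷ cs)

beside : List PTree → Plucking → Plucking
beside ds (r , cs′) = (r , node ds ∷ cs′)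

pluckF-node : ∀ ds cs →
  pluckF (node ds ∷ cs) ≡ leafPlucking ds cs ++ map (under cs) (pluckF ds) ++ map (beside ds) (pluckF cs)
pluckF-node []      cs = refl
pluckF-node (_ ∷ _) cs = refl

withRight : List PTree → Plucking → Plucking
withRight B (r , A′) = (r ℕ.+ edgesF B , A′ ++ B)

withLeft : List PTree → Plucking → Plucking
withLeft A (r , B′) = (r , A ++ B′)

map-++-++ : ∀ {A B : Set} (f : A → B) xs ys zs ws →
  map f (xs ++ ys ++ zs) ++ ws ≡ map f xs ++ map f ys ++ map f zs ++ ws
map-++-++ f (x ∷ xs) ys       zs ws = cong (f x ∷_) (map-++-++ f xs ys zs ws)
map-++-++ f []       (y ∷ ys) zs ws = cong (f y ∷_) (map-++-++ f [] ys zs ws)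
map-++-++ f []       []       zs ws = refl

pluckF-++ : ∀ A B → pluckF (A ++ B) ≡ map (withRight B) (pluckF A) ++ map (withLeft A) (pluckF B)
pluckF-++ []             B = sym (ListP.map-id (pluckF B))
pluckF-++ (node ds ∷ cs) B = begin
  pluckF (node ds ∷ cs ++ B)
    ≡⟨ pluckF-node ds (cs ++ B) ⟩
  leafPlucking ds (cs ++ B) ++ map (under (cs ++ B)) (pluckF ds) ++ map (beside ds) (pluckF (cs ++ B))
    ≡⟨ cong (λ l → leafPlucking ds (cs ++ B) ++ map (under (cs ++ B)) (pluckF ds) ++ map (beside ds) l)
            (pluckF-++ cs B) ⟩
  leafPlucking ds (cs ++ B) ++ map (under (cs ++ B)) (pluckF ds)
    ++ map (beside ds) (map (withRight B) (pluckF cs) ++ map (withLeft cs) (pluckF B))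
    ≡⟨ cong₂ _++_ (leaf-withRight ds) (cong₂ _++_ under-withRight beside-++) ⟩
  map (withRight B) (leafPlucking ds cs) ++ map (withRight B) (map (under cs) (pluckF ds))
    ++ map (withRight B) (map (beside ds) (pluckF cs)) ++ map (withLeft (node ds ∷ cs)) (pluckF B)
    ≡⟨ map-++-++ (withRight B) (leafPlucking ds cs) (map (under cs) (pluckF ds)) (map (beside ds) (pluckF cs)) _ ⟨
  map (withRight B) (leafPlucking ds cs ++ map (under cs) (pluckF ds) ++ map (beside ds) (pluckF cs))
    ++ map (withLeft (node ds ∷ cs)) (pluckF B)
    ≡⟨ cong (λ l → map (withRight B) l ++ map (withLeft (node ds ∷ cs)) (pluckF B)) (pluckF-node ds cs) ⟨
  map (withRight B) (pluckF (node ds ∷ cs)) ++ map (withLeft (node ds ∷ cs)) (pluckF B) ∎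
  where
  open ≡-Reasoning

  leaf-withRight : ∀ ds → leafPlucking ds (cs ++ B) ≡ map (withRight B) (leafPlucking ds cs)
  leaf-withRight []      = cong (λ e → (e , cs ++ B) ∷ []) (edgesF-++ cs B)
  leaf-withRight (_ ∷ _) = refl

  under-withRight : map (under (cs ++ B)) (pluckF ds) ≡ map (withRight B) (map (under cs) (pluckF ds))
  under-withRight = trans (ListP.map-cong shift (pluckF ds)) (ListP.map-∘ (pluckF ds))
    where
    shift : ∀ x → under (cs ++ B) x ≡ withRight B (under cs x)
    shift (r , ds′) = cong (λ e → (e , node ds′ ∷ cs ++ B))
      (trans (cong (r ℕ.+_) (edgesF-++ cs B)) (sym (ℕP.+-assoc r (edgesF cs) (edgesF B))))

  beside-++ : map (beside ds) (map (withRight B) (pluckF cs) ++ map (withLeft cs) (pluckF B))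
            ≡ map (withRight B) (map (beside ds) (pluckF cs)) ++ map (withLeft (node ds ∷ cs)) (pluckF B)
  beside-++ = trans (ListP.map-++ (beside ds) (map (withRight B) (pluckF cs)) (map (withLeft cs) (pluckF B))) (cong₂ _++_
    (trans (sym (ListP.map-∘ {g = beside ds} {f = withRight B} (pluckF cs))) (ListP.map-∘ (pluckF cs)))
    (sym (ListP.map-∘ {g = beside ds} {f = withLeft cs} (pluckF B))))

RemovesOneEdgeOf : List PTree → Plucking → Set
RemovesOneEdgeOf F x = suc (edgesF (proj₂ x)) ≡ edgesF F

pluckF-edges : ∀ F → All (RemovesOneEdgeOf F) (pluckF F)
pluckF-edges []             = []
pluckF-edges (node ds ∷ cs) = subst (All (RemovesOneEdgeOf (node ds ∷ cs))) (sym (pluckF-node ds cs))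
  (AllP.++⁺ (leaf ds) (AllP.++⁺
    (AllP.map⁺ (All.map (cong (λ e → suc (e ℕ.+ edgesF cs))) (pluckF-edges ds)))
    (AllP.map⁺ (All.map (λ {x} e → cong suc (trans (sym (ℕP.+-suc (edgesF ds) (edgesF (proj₂ x))))
                                                  (cong (edgesF ds ℕ.+_) e)))
                        (pluckF-edges cs)))))
  where
  leaf : ∀ ds → All (RemovesOneEdgeOf (node ds ∷ cs)) (leafPlucking ds cs)
  leaf []      = refl ∷ []
  leaf (_ ∷ _) = []

pluckTerm : Plucking → Poly
pluckTerm (r , F) = qpow r *P Q (node F)

Q-pluck : ∀ {m} F → edgesF F ≡ suc m → Q (node F) ≡ sumP (map pluckTerm (pluckF F))
Q-pluck (c ∷ cs) refl = cong sumP (trans (sym (ListP.map-∘ (pluckF (c ∷ cs))))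
  (ListP.map-cong-local (All.map (λ {x} → exact-fuel {x}) (pluckF-edges (c ∷ cs)))))
  where
  exact-fuel : ∀ {x} → RemovesOneEdgeOf (c ∷ cs) x →
    qpow (proj₁ x) *P Q' (edges c ℕ.+ edgesF cs) (node (proj₂ x)) ≡ pluckTerm x
  exact-fuel {x} e = cong (λ k → qpow (proj₁ x) *P Q' k (node (proj₂ x))) (ℕP.suc-injective (sym e))

-- Plucking polynomials of concatenations and wedges

-- [e]! = [e] [e-1]!, and the factor [e-1]! is absorbed by each summand of the plucking recursion.
sum-over-pluckings : ∀ K C F (f : Plucking → Poly) →
  (∀ r F′ → suc (edgesF F′) ≡ edgesF F → K *P qfact (edgesF F′) *P f (r , F′) ≋ C *P pluckTerm (r , F′)) →
  K *P qfact (edgesF F) *P sumP (map f (pluckF F)) ≋ qint (edgesF F) *P C *P Q (node F)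
sum-over-pluckings K C []       f hyp = *P-zeroʳ (K *P oneP)
sum-over-pluckings K C (c ∷ cs) f hyp = begin
  K *P (qint (suc m) *P qfact m) *P sumP (map f xs)
    ≈⟨ solve 4 (λ K i m! S → K :* (i :* m!) :* S := i :* (K :* m! :* S)) ≋-refl
               K (qint (suc m)) (qfact m) (sumP (map f xs)) ⟩
  qint (suc m) *P (K *P qfact m *P sumP (map f xs))
    ≈⟨ *P-congʳ (qint (suc m)) (*P-sumP (K *P qfact m) f xs) ⟩
  qint (suc m) *P sumP (map (λ x → K *P qfact m *P f x) xs)
    ≈⟨ *P-congʳ (qint (suc m)) (sumP-cong (All.map (λ {x} → term {x}) (pluckF-edges (c ∷ cs)))) ⟩
  qint (suc m) *P sumP (map (λ x → C *P pluckTerm x) xs)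
    ≈⟨ *P-congʳ (qint (suc m)) (*P-sumP C pluckTerm xs) ⟨
  qint (suc m) *P (C *P sumP (map pluckTerm xs))
    ≡⟨ cong (λ s → qint (suc m) *P (C *P s)) (Q-pluck (c ∷ cs) refl) ⟨
  qint (suc m) *P (C *P Q (node (c ∷ cs)))
    ≈⟨ *P-assoc (qint (suc m)) C (Q (node (c ∷ cs))) ⟨
  qint (suc m) *P C *P Q (node (c ∷ cs)) ∎
  where
  open ≋-Reasoning
  m  = edges c ℕ.+ edgesF cs
  xs = pluckF (c ∷ cs)

  term : ∀ {x} → RemovesOneEdgeOf (c ∷ cs) x → K *P qfact m *P f x ≋ C *P pluckTerm x
  term {r , F′} e = ≋-trans (≡⇒≋ (cong (λ k → K *P qfact k *P f (r , F′)) (ℕP.suc-injective (sym e))))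
                            (hyp r F′ e)

Q-++-of-size : ∀ m A B → edgesF A ℕ.+ edgesF B ≡ m →
  qfact (edgesF A) *P qfact (edgesF B) *P Q (node (A ++ B)) ≋ qfact m *P Q (node A) *P Q (node B)
Q-++-of-size zero    []      []      refl = ≋-refl
Q-++-of-size zero    []      (_ ∷ _) ()
Q-++-of-size zero    (_ ∷ _) _       ()
Q-++-of-size (suc m) A B a+b≡ = begin
  qfact a *P qfact b *P Q (node (A ++ B))
    ≡⟨ cong (λ s → qfact a *P qfact b *P s) (Q-pluck (A ++ B) (trans (edgesF-++ A B) a+b≡)) ⟩
  qfact a *P qfact b *P sumP (map pluckTerm (pluckF (A ++ B)))
    ≈⟨ *P-congʳ (qfact a *P qfact b) split ⟩
  qfact a *P qfact b *P (ΣA +P ΣB)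
    ≈⟨ *P-distribˡ (qfact a *P qfact b) ΣA ΣB ⟩
  qfact a *P qfact b *P ΣA +P qfact a *P qfact b *P ΣB
    ≈⟨ +P-cong left right ⟩
  qint a *P (qpow b *P qfact m *P QB) *P QA +P qint b *P (qfact m *P QA) *P QB
    ≈⟨ solve 6 (λ i q j m! QA QB → i :* (q :* m! :* QB) :* QA :+ j :* (m! :* QA) :* QB
                                 := (q :* i :+ j) :* m! :* QA :* QB)
               ≋-refl (qint a) (qpow b) (qint b) (qfact m) QA QB ⟩
  (qpow b *P qint a +P qint b) *P qfact m *P QA *P QB
    ≈⟨ *P-congˡ QB (*P-congˡ QA (*P-congˡ (qfact m) pascal)) ⟨
  qint (suc m) *P qfact m *P QA *P QB ∎
  where
  open ≋-Reasoning
  a  = edgesF A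
  b  = edgesF B
  QA = Q (node A)
  QB = Q (node B)
  ΣA = sumP (map (pluckTerm ∘ withRight B) (pluckF A))
  ΣB = sumP (map (pluckTerm ∘ withLeft A) (pluckF B))

  pascal : qint (suc m) ≋ qpow b *P qint a +P qint b
  pascal = ≋-trans (≡⇒≋ (cong qint (trans (sym a+b≡) (ℕP.+-comm a b)))) (qint-+ b a)

  split : sumP (map pluckTerm (pluckF (A ++ B))) ≋ ΣA +P ΣB
  split = ≋-trans (≡⇒≋ (cong sumP (trans (cong (map pluckTerm) (pluckF-++ A B))
            (trans (ListP.map-++ pluckTerm (map (withRight B) (pluckF A)) (map (withLeft A) (pluckF B)))
                   (cong₂ _++_ (sym (ListP.map-∘ (pluckF A))) (sym (ListP.map-∘ (pluckF B))))))))
          (sumP-++ (map (pluckTerm ∘ withRight B) (pluckF A)) (map (pluckTerm ∘ withLeft A) (pluckF B)))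

  left : qfact a *P qfact b *P ΣA ≋ qint a *P (qpow b *P qfact m *P QB) *P QA
  left = ≋-trans (*P-congˡ ΣA (*P-comm (qfact a) (qfact b)))
    (sum-over-pluckings (qfact b) (qpow b *P qfact m *P QB) A (pluckTerm ∘ withRight B) term)
    where
    term : ∀ r A′ → suc (edgesF A′) ≡ a →
      qfact b *P qfact (edgesF A′) *P (qpow (r ℕ.+ b) *P Q (node (A′ ++ B)))
        ≋ qpow b *P qfact m *P QB *P (qpow r *P Q (node A′))
    term r A′ e = begin
      qfact b *P qfact (edgesF A′) *P (qpow (r ℕ.+ b) *P Q (node (A′ ++ B)))
        ≈⟨ *P-congʳ (qfact b *P qfact (edgesF A′)) (*P-congˡ (Q (node (A′ ++ B))) (qpow-+ r b)) ⟩
      qfact b *P qfact (edgesF A′) *P (qpow r *P qpow b *P Q (node (A′ ++ B)))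
        ≈⟨ solve 5 (λ b! a! qr qb Y → b! :* a! :* (qr :* qb :* Y) := qr :* qb :* (a! :* b! :* Y))
                   ≋-refl (qfact b) (qfact (edgesF A′)) (qpow r) (qpow b) (Q (node (A′ ++ B))) ⟩
      qpow r *P qpow b *P (qfact (edgesF A′) *P qfact b *P Q (node (A′ ++ B)))
        ≈⟨ *P-congʳ (qpow r *P qpow b)
                    (Q-++-of-size m A′ B (ℕP.suc-injective (trans (cong (ℕ._+ b) e) a+b≡))) ⟩
      qpow r *P qpow b *P (qfact m *P Q (node A′) *P QB)
        ≈⟨ solve 5 (λ qr qb m! QA′ QB → qr :* qb :* (m! :* QA′ :* QB) := qb :* m! :* QB :* (qr :* QA′))
                   ≋-refl (qpow r) (qpow b) (qfact m) (Q (node A′)) QB ⟩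
      qpow b *P qfact m *P QB *P (qpow r *P Q (node A′)) ∎

  right : qfact a *P qfact b *P ΣB ≋ qint b *P (qfact m *P QA) *P QB
  right = sum-over-pluckings (qfact a) (qfact m *P QA) B (pluckTerm ∘ withLeft A) term
    where
    term : ∀ r B′ → suc (edgesF B′) ≡ b →
      qfact a *P qfact (edgesF B′) *P (qpow r *P Q (node (A ++ B′))) ≋ qfact m *P QA *P (qpow r *P Q (node B′))
    term r B′ e = begin
      qfact a *P qfact (edgesF B′) *P (qpow r *P Q (node (A ++ B′)))
        ≈⟨ solve 4 (λ a! b! qr Y → a! :* b! :* (qr :* Y) := qr :* (a! :* b! :* Y))
                   ≋-refl (qfact a) (qfact (edgesF B′)) (qpow r) (Q (node (A ++ B′))) ⟩
      qpow r *P (qfact a *P qfact (edgesF B′) *P Q (node (A ++ B′)))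
        ≈⟨ *P-congʳ (qpow r) (Q-++-of-size m A B′ (ℕP.suc-injective
             (trans (sym (ℕP.+-suc a (edgesF B′))) (trans (cong (a ℕ.+_) e) a+b≡)))) ⟩
      qpow r *P (qfact m *P QA *P Q (node B′))
        ≈⟨ solve 4 (λ qr m! QA QB′ → qr :* (m! :* QA :* QB′) := m! :* QA :* (qr :* QB′))
                   ≋-refl (qpow r) (qfact m) QA (Q (node B′)) ⟩
      qfact m *P QA *P (qpow r *P Q (node B′)) ∎

Q-++ : ∀ A B →
  qfact (edgesF A) *P qfact (edgesF B) *P Q (node (A ++ B))
    ≋ qfact (edgesF A ℕ.+ edgesF B) *P Q (node A) *P Q (node B)
Q-++ A B = Q-++-of-size (edgesF A ℕ.+ edgesF B) A B refl

-- Q-++ only applies after multiplying by qfact b, which is then cancelled.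
Q-++-step : ∀ A B {w} P PQ → edgesF B ≡ w → P *P Q (node B) ≋ qfact w *P PQ →
  qfact (edgesF A) *P P *P Q (node (A ++ B)) ≋ qfact (edgesF A ℕ.+ w) *P (Q (node A) *P PQ)
Q-++-step A B P PQ refl ih = *P-cancelʳ (qfact-constant b) (begin
  qfact a *P P *P Q (node (A ++ B)) *P qfact b
    ≈⟨ solve 4 (λ a! P Y b! → a! :* P :* Y :* b! := P :* (a! :* b! :* Y))
               ≋-refl (qfact a) P (Q (node (A ++ B))) (qfact b) ⟩
  P *P (qfact a *P qfact b *P Q (node (A ++ B)))
    ≈⟨ *P-congʳ P (Q-++ A B) ⟩
  P *P (qfact (a ℕ.+ b) *P QA *P Q (node B))
    ≈⟨ solve 4 (λ P n! QA QB → P :* (n! :* QA :* QB) := n! :* QA :* (P :* QB))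
               ≋-refl P (qfact (a ℕ.+ b)) QA (Q (node B)) ⟩
  qfact (a ℕ.+ b) *P QA *P (P *P Q (node B))
    ≈⟨ *P-congʳ (qfact (a ℕ.+ b) *P QA) ih ⟩
  qfact (a ℕ.+ b) *P QA *P (qfact b *P PQ)
    ≈⟨ solve 4 (λ n! QA b! PQ → n! :* QA :* (b! :* PQ) := n! :* (QA :* PQ) :* b!)
               ≋-refl (qfact (a ℕ.+ b)) QA (qfact b) PQ ⟩
  qfact (a ℕ.+ b) *P (QA *P PQ) *P qfact b ∎)
  where
  open ≋-Reasoning
  a  = edgesF A
  b  = edgesF B
  QA = Q (node A)

Q-wedge : ∀ ts →
  prodP (map (λ t → qfact (edges t)) ts) *P Q (wedge ts) ≋ qfact (sum (map edges ts)) *P prodP (map Q ts)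
Q-wedge []            = ≋-refl
Q-wedge (node A ∷ ts) = Q-++-step A (concatMap children ts) _ _ (edges-wedge ts) (Q-wedge ts)

corollary2p3 : (ts : List PTree) → 1 ≤ length ts →
    prodP (map (λ t → qfact (edges t)) ts) *P Q (wedge ts)
      ≈P qfact (sum (map edges ts)) *P prodP (map Q ts)
corollary2p3 ts _ = coeff-≡ (Q-wedge ts)
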